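{- The set $\{E^*_{\mathbf a}A_{\mathbf b}E^*_{\mathbf c}:(\mathbf a,\mathbf b,\mathbf c)\in\mathbb{P}\}$ is an $\mathbb{F}$-basis of $\mathbb{T}$, and it has cardinality $2^{2n_1}5^{n_2}$.
   Context: Let $\mathbb{F}$ be a field. Let $n\ge 1$ and let $U_1,\dots,U_n$ be finite sets with $|U_h|\ge 2$. Put $X=U_1\times\cdots\times U_n$ and $E=\{0,1\}^n$. For $\mathbf g\in E$ let $S(\mathbf g)=\{a:\mathbf g_a=1\}$. For $V\subseteq\{1,\dots,n\}$ let $V^\circ=\{a\in V:|U_a|>2\}$. Let $R_{\mathbf g}=\{(\mathbf y,\mathbf z)\in X\times X:\ \mathbf y_a\neq\mathbf z_a\iff\mathbf g_a=1\}$ (the factorial scheme). Let $A_{\mathbf g}\in\mathrm{M}_X(\mathbb{F})$ be the $\{0,1\}$ adjacency matrix of $R_{\mathbf g}$. Fix $\mathbf x\in X$ and let $E^*_{\mathbf g}$ be the diagonal matrix with $(\mathbf y,\mathbf y)$-entry $1$ iff $(\mathbf x,\mathbf y)\in R_{\mathbf g}$, else $0$. $\mathbb{T}$ is the $\mathbb{F}$-subalgebra of $\mathrm{M}_X(\mathbb{F})$ generated by all $A_{\mathbf g},E^*_{\mathbf g}$. Let $n_1=|\{a:|U_a|=2\}|$, $n_2=|\{a:|U_a|>2\}|$. Let $\mathbb{P}$ be the set of $(\mathbf a,\mathbf b,\mathbf c)\in E^3$ with $S(\mathbf a)\triangle S(\mathbf c)\subseteq S(\mathbf b)\subseteq(S(\mathbf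 a)\triangle S(\mathbf c))\cup(S(\mathbf a)\cap S(\mathbf c))^\circ$. -}

module Defs where

open import Level using (Level; _⊔_; suc)
open import Data.Nat as ℕ using (ℕ; _≤_; _<_)
open import Data.Fin as Fin using (Fin)
open import Data.Bool using (Bool; true; false; _∧_; _∨_; not; _xor_; if_then_else_; T)
open import Data.List as List using (List; []; _∷_; foldr; map; filter; length; concatMap)
open import Data.Vec using (Vec; lookup) renaming (_∷_ to _∷ᵥ_; [] to []ᵥ)
open import Data.Product using (Σ; _×_; _,_; ∃)
open import Relation.Nullary using (¬_; does)
open import Relation.Nullary.Decidable using (⌊_⌋)
open import Algebra.Bundles using (CommutativeRing)

record Field (c ℓ : Level) : Set (Level.suc (c ⊔ ℓ)) where
  field
    commutativeRing : CommutativeRing c ℓ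
  open CommutativeRing commutativeRing public
  field
    1≉0     : ¬ (1# ≈ 0#)
    inverse : ∀ x → ¬ (x ≈ 0#) → Σ Carrier (λ y → (x * y) ≈ 1#)

-- The factorial scheme data.  The sets U_h are modelled as Fin (m h).

Pt : (n : ℕ) → (Fin n → ℕ) → Set
Pt n m = (h : Fin n) → Fin (m h)

Bits : ℕ → Set
Bits n = Vec Bool n

allPt : (n : ℕ) (m : Fin n → ℕ) → List (Pt n m)
allPt ℕ.zero    m = (λ ()) ∷ []
allPt (ℕ.suc n) m =
  concatMap (λ i → map (λ f → cons i f) (allPt n (λ h → m (Fin.suc h))))
            (List.allFin (m Fin.zero))
  where
  cons : Fin (m Fin.zero) → Pt n (λ h → m (Fin.suc h)) → Pt (ℕ.suc n) m
  cons i f Fin.zero    = i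
  cons i f (Fin.suc h) = f h

allBits : (n : ℕ) → List (Bits n)
allBits ℕ.zero    = []ᵥ ∷ []
allBits (ℕ.suc n) = concatMap (λ v → (false ∷ᵥ v) ∷ (true ∷ᵥ v) ∷ []) (allBits n)

allᵇ : (n : ℕ) → (Fin n → Bool) → Bool
allᵇ n p = foldr _∧_ true (map p (List.allFin n))

countᵇ : (n : ℕ) → (Fin n → Bool) → ℕ
countᵇ n p = length (filter (λ a → T? (p a)) (List.allFin n))
  where
  open import Data.Bool.Properties using (T?)

inRᵇ : ∀ {n m} → Bits n → Pt n m → Pt n m → Bool
inRᵇ {n} g y z = allᵇ n (λ a → ⌊ not ⌊ y a Fin.≟ z a ⌋ ≟ᵇ lookup g a ⌋)
  where open import Data.Bool using () renaming (_≟_ to _≟ᵇ_)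

bigᵇ : ∀ {n} → (Fin n → ℕ) → Fin n → Bool
bigᵇ m a = ⌊ 2 ℕ.<? m a ⌋

-- S(a) △ S(c) ⊆ S(b) ⊆ (S(a) △ S(c)) ∪ (S(a) ∩ S(c))°, checked pointwise
inℙᵇ : ∀ {n} → (Fin n → ℕ) → Bits n → Bits n → Bits n → Bool
inℙᵇ {n} m a b c =
  allᵇ n (λ h → implies (lookup a h xor lookup c h) (lookup b h)
              ∧ implies (lookup b h) ((lookup a h xor lookup c h) ∨ (lookup a h ∧ lookup c h ∧ bigᵇ m h)))
  where
  implies : Bool → Bool → Bool
  implies p q = not p ∨ q

Inℙ : ∀ {n} → (Fin n → ℕ) → Bits n → Bits n → Bits n → Set
Inℙ m a b c = T (inℙᵇ m a b c)

allTriples : (n : ℕ) → List (Bits n × Bits n × Bits n)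
allTriples n =
  concatMap (λ a → concatMap (λ b → map (λ c → (a , b , c)) (allBits n)) (allBits n)) (allBits n)

cardℙ : (n : ℕ) → (Fin n → ℕ) → ℕ
cardℙ n m = length (filter (λ { (a , b , c) → T? (inℙᵇ m a b c) }) (allTriples n))
  where open import Data.Bool.Properties using (T?)

n₁ n₂ : (n : ℕ) → (Fin n → ℕ) → ℕ
n₁ n m = countᵇ n (λ a → ⌊ m a ℕ.≟ 2 ⌋)
n₂ n m = countᵇ n (bigᵇ m)

module Matrices {c ℓ} (𝔽 : Field c ℓ) (n : ℕ) (m : Fin n → ℕ) where
  open Field 𝔽

  Mat : Set c
  Mat = Pt n m → Pt n m → Carrier

  _≈ₘ_ : Mat → Mat → Set ℓ
  M ≈ₘ N = ∀ y z → M y z ≈ N y z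

  sumL : ∀ {i} {I : Set i} → List I → (I → Carrier) → Carrier
  sumL xs f = foldr (λ i r → f i + r) 0# xs

  eqᵇ : Pt n m → Pt n m → Bool
  eqᵇ y z = allᵇ n (λ a → ⌊ y a Fin.≟ z a ⌋)

  0ₘ 1ₘ : Mat
  0ₘ y z = 0#
  1ₘ y z = if eqᵇ y z then 1# else 0#

  _+ₘ_ _*ₘ_ : Mat → Mat → Mat
  (M +ₘ N) y z = M y z + N y z
  (M *ₘ N) y z = sumL (allPt n m) (λ w → M y w * N w z)

  _·ₘ_ : Carrier → Mat → Mat
  (k ·ₘ M) y z = k * M y z

  A : Bits n → Mat
  A g y z = if inRᵇ g y z then 1# else 0#

  E* : Pt n m → Bits n → Mat
  E* x g y z = if eqᵇ y z ∧ inRᵇ g x y then 1# else 0#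

  data InT (x : Pt n m) : Mat → Set (c ⊔ ℓ) where
    genA  : ∀ g → InT x (A g)
    genE* : ∀ g → InT x (E* x g)
    one   : InT x 1ₘ
    nil   : InT x 0ₘ
    plus  : ∀ {M N} → InT x M → InT x N → InT x (M +ₘ N)
    times : ∀ {M N} → InT x M → InT x N → InT x (M *ₘ N)
    scale : ∀ k {M} → InT x M → InT x (k ·ₘ M)
    resp  : ∀ {M N} → M ≈ₘ N → InT x M → InT x N

  Triple : Set
  Triple = Bits n × Bits n × Bits n

  ℙlist : List Triple
  ℙlist = filter (λ { (a , b , c) → T? (inℙᵇ m a b c) }) (allTriples n)
    where open import Data.Bool.Properties using (T?)

  basisElt : Pt n m → Triple → Mat
  basisElt x (a , b , c) = (E* x a *ₘ A b) *ₘ E* x c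

  comb : Pt n m → (Triple → Carrier) → Mat
  comb x κ = foldr (λ t M → (κ t ·ₘ basisElt x t) +ₘ M) 0ₘ ℙlist

module Submission where

-- For y, z ∈ X let rel³ y z = (a, b, c) be the triple with (x, y) ∈ R_a, (y, z) ∈ R_b and
-- (x, z) ∈ R_c; then E*_a A_b E*_c is the 0/1 matrix of the pairs (y, z) with rel³ y z = (a, b, c).
-- In each coordinate h the points x_h, y_h, z_h are all equal, or exactly two of them coincide,
-- or (only if |U_h| > 2) they are pairwise distinct.  This is precisely the condition defining ℙ,
-- so rel³ takes every value in ℙ and no other, the matrices E*_a A_b E*_c with (a, b, c) ∈ ℙ have
-- disjoint nonempty supports, and |ℙ| is a product of 4 or 5 choices per coordinate.
-- For spanning, permuting each U_h by a permutation fixing x_h preserves every R_g, and these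
-- permutations act transitively on the pairs (y, z) with a given rel³ y z.  Hence if the entries
-- of M and N depend only on rel³, so do those of M N, and by induction every element of 𝕋 is a
-- combination of the E*_a A_b E*_c.

open import Defs
open import Level using (Level; _⊔_)
open import Data.Nat as ℕ using (ℕ; zero; suc)
import Data.Nat.Properties as ℕₚ
open import Data.Fin as Fin using (Fin; zero; suc)
import Data.Fin.Properties as Finₚ
open import Data.Fin.Permutation using (Permutation′; transpose; _⟨$⟩ʳ_; _⟨$⟩ˡ_; inverseˡ; inverseʳ; _∘ₚ_)
open import Data.Bool as Bool using (Bool; true; false; T; if_then_else_; _∧_; _∨_; not; _xor_)
import Data.Bool.Properties as Boolₚ
open import Data.List as List using (List; []; _∷_; _++_; map; filter; concatMap; length; allFin)
import Data.List.Properties as Listₚ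
import Data.List.Relation.Unary.All as All
import Data.List.Relation.Unary.All.Properties as Allₚ
open import Data.List.Membership.Propositional.Properties using (∈-allFin)
open import Data.Vec as Vec using (Vec; lookup) renaming ([] to []ᵥ; _∷_ to _∷ᵥ_)
import Data.Vec.Properties as Vecₚ
open import Data.Product using (Σ; _×_; _,_; proj₁; proj₂)
open import Data.Empty using (⊥-elim)
open import Function using (_∘_; id)
open import Function.Bundles using (_⇔_; mk⇔; Equivalence; Inverse)
open import Function.Properties.Equivalence using () renaming (trans to ⇔-trans; sym to ⇔-sym)
open import Relation.Nullary using (¬_; Dec; yes; no; does)
open import Relation.Nullary.Decidable
  using (⌊_⌋; toWitness; fromWitness; isYes≗does; does-⇔; dec-true; dec-false; map′; _×-dec_)
open import Relation.Unary using (Pred; Decidable)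
open import Relation.Binary.PropositionalEquality as ≡ using (_≡_; _≢_)
open import Algebra.Bundles using (CommutativeSemiring)

open Equivalence using (to; from)

_≐_ : ∀ {n m} → Pt n m → Pt n m → Set
u ≐ v = ∀ h → u h ≡ v h

≐-refl : ∀ {n m} {u : Pt n m} → u ≐ u
≐-refl _ = ≡.refl

≐-sym : ∀ {n m} {u v : Pt n m} → u ≐ v → v ≐ u
≐-sym u≐v h = ≡.sym (u≐v h)

module ListSum {c ℓ} (R : CommutativeSemiring c ℓ) where
  open CommutativeSemiring R hiding (zero)
  open import Algebra.Properties.CommutativeSemigroup +-commutativeSemigroup using (interchange)
  open import Relation.Binary.Reasoning.Setoid setoid

  ∑ : ∀ {i} {I : Set i} → List I → (I → Carrier) → Carrier
  ∑ xs f = List.foldr (λ i r → f i + r) 0# xs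

  module _ {i} {I : Set i} where

    ∑-cong : ∀ (xs : List I) {f g : I → Carrier} → (∀ x → f x ≈ g x) → ∑ xs f ≈ ∑ xs g
    ∑-cong []       f≈g = refl
    ∑-cong (x ∷ xs) f≈g = +-cong (f≈g x) (∑-cong xs f≈g)

    ∑-zero : ∀ (xs : List I) {f : I → Carrier} → (∀ x → f x ≈ 0#) → ∑ xs f ≈ 0#
    ∑-zero []       f≈0 = refl
    ∑-zero (x ∷ xs) f≈0 = trans (+-cong (f≈0 x) (∑-zero xs f≈0)) (+-identityˡ 0#)

    ∑-++ : ∀ (xs ys : List I) (f : I → Carrier) → ∑ (xs ++ ys) f ≈ ∑ xs f + ∑ ys f
    ∑-++ []       ys f = sym (+-identityˡ _)
    ∑-++ (x ∷ xs) ys f = trans (+-cong refl (∑-++ xs ys f)) (sym (+-assoc _ _ _))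

    ∑-+ : ∀ (xs : List I) (f g : I → Carrier) → ∑ xs (λ x → f x + g x) ≈ ∑ xs f + ∑ xs g
    ∑-+ []       f g = sym (+-identityˡ 0#)
    ∑-+ (x ∷ xs) f g = trans (+-cong refl (∑-+ xs f g)) (interchange _ _ _ _)

    ∑-*ˡ : ∀ (xs : List I) (k : Carrier) (f : I → Carrier) → k * ∑ xs f ≈ ∑ xs (λ x → k * f x)
    ∑-*ˡ []       k f = zeroʳ k
    ∑-*ˡ (x ∷ xs) k f = trans (distribˡ _ _ _) (+-cong refl (∑-*ˡ xs k f))

    ∑-*ʳ : ∀ (xs : List I) (k : Carrier) (f : I → Carrier) → ∑ xs f * k ≈ ∑ xs (λ x → f x * k)
    ∑-*ʳ xs k f = trans (*-comm _ _) (trans (∑-*ˡ xs k f) (∑-cong xs (λ x → *-comm _ _)))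

    ∑-filter : ∀ {p} {P : Pred I p} (P? : Decidable P) (xs : List I) (f : I → Carrier) →
               ∑ (filter P? xs) f ≈ ∑ xs (λ x → if does (P? x) then f x else 0#)
    ∑-filter P? []       f = refl
    ∑-filter P? (x ∷ xs) f with does (P? x)
    ... | true  = +-cong refl (∑-filter P? xs f)
    ... | false = trans (∑-filter P? xs f) (sym (+-identityˡ _))

  module _ {i j} {I : Set i} {J : Set j} where

    ∑-map : ∀ (g : J → I) (xs : List J) (f : I → Carrier) → ∑ (map g xs) f ≈ ∑ xs (f ∘ g)
    ∑-map g []       f = refl
    ∑-map g (x ∷ xs) f = +-cong refl (∑-map g xs f)

    ∑-concatMap : ∀ (g : J → List I) (xs : List J) (f : I → Carrier) →
                  ∑ (concatMap g xs) f ≈ ∑ xs (λ x → ∑ (g x) f)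
    ∑-concatMap g []       f = refl
    ∑-concatMap g (x ∷ xs) f =
      trans (∑-++ (g x) (concatMap g xs) f) (+-cong refl (∑-concatMap g xs f))

    ∑-swap : ∀ (xs : List I) (ys : List J) (f : I → J → Carrier) →
             ∑ xs (λ x → ∑ ys (f x)) ≈ ∑ ys (λ y → ∑ xs (λ x → f x y))
    ∑-swap []       ys f = sym (∑-zero ys (λ _ → refl))
    ∑-swap (x ∷ xs) ys f = trans (+-cong refl (∑-swap xs ys f)) (sym (∑-+ ys (f x) _))

  ∑-allFin-suc : ∀ k (f : Fin (suc k) → Carrier) →
                 ∑ (allFin (suc k)) f ≈ f zero + ∑ (allFin k) (f ∘ suc)
  ∑-allFin-suc k f =
    +-cong refl (trans (reflexive (≡.cong (λ l → ∑ l f) (≡.sym (Listₚ.map-tabulate id suc))))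
                       (∑-map suc (allFin k) f))

  ∑-allFin-support : ∀ k (j : Fin k) (f : Fin k → Carrier) → (∀ i → i ≢ j → f i ≈ 0#) →
                     ∑ (allFin k) f ≈ f j
  ∑-allFin-support (suc k) zero f off =
    trans (∑-allFin-suc k f)
          (trans (+-cong refl (∑-zero (allFin k) (λ i → off (suc i) λ ()))) (+-identityʳ _))
  ∑-allFin-support (suc k) (suc j) f off =
    trans (∑-allFin-suc k f)
          (trans (+-cong (off zero λ ())
                         (∑-allFin-support k j (f ∘ suc) (λ i i≢j → off (suc i) (i≢j ∘ Finₚ.suc-injective))))
                 (+-identityˡ _))

  EnumeratesOnce : ∀ {n m} → List (Pt n m) → Set (c ⊔ ℓ)
  EnumeratesOnce {n} {m} L = ∀ (u : Pt n m) (f : Pt n m → Carrier) →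
    (∀ v → ¬ v ≐ u → f v ≈ 0#) → (∀ v → v ≐ u → f v ≈ f u) → ∑ L f ≈ f u

  enumeratesOnce-concatMap : ∀ {n} {m : Fin (suc n) → ℕ}
    (cons : Fin (m zero) → Pt n (m ∘ suc) → Pt (suc n) m) →
    (∀ i v → cons i v zero ≡ i) → (∀ i v h → cons i v (suc h) ≡ v h) →
    ∀ {L} → EnumeratesOnce L → EnumeratesOnce (concatMap (λ i → map (cons i) L) (allFin (m zero)))
  enumeratesOnce-concatMap {m = m} cons cons-zero cons-suc {L} once u f off on = begin
    ∑ (concatMap (λ i → map (cons i) L) (allFin (m zero))) f ≈⟨ ∑-concatMap _ (allFin (m zero)) f ⟩
    ∑ (allFin (m zero)) (λ i → ∑ (map (cons i) L) f)        ≈⟨ ∑-cong (allFin (m zero)) (λ i → ∑-map (cons i) L f) ⟩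
    ∑ (allFin (m zero)) (λ i → ∑ L (f ∘ cons i))            ≈⟨ ∑-allFin-support _ (u zero) _ other-rows ⟩
    ∑ L (f ∘ cons (u zero))                                 ≈⟨ once (u ∘ suc) (f ∘ cons (u zero)) off-row on-row ⟩
    f (cons (u zero) (u ∘ suc))                             ≈⟨ on _ cons-u ⟩
    f u                                                     ∎
    where
    cons-u : cons (u zero) (u ∘ suc) ≐ u
    cons-u zero    = cons-zero _ _
    cons-u (suc h) = cons-suc _ _ h

    other-rows : ∀ i → i ≢ u zero → ∑ L (f ∘ cons i) ≈ 0#
    other-rows i i≢u₀ = ∑-zero L (λ v → off _ (λ e → i≢u₀ (≡.trans (≡.sym (cons-zero i v)) (e zero))))

    off-row : ∀ v → ¬ v ≐ (u ∘ suc) → f (cons (u zero) v) ≈ 0#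
    off-row v v≉u = off _ (λ e → v≉u (λ h → ≡.trans (≡.sym (cons-suc _ v h)) (e (suc h))))

    on-row : ∀ v → v ≐ (u ∘ suc) → f (cons (u zero) v) ≈ f (cons (u zero) (u ∘ suc))
    on-row v v≐u = trans (on _ λ { zero → cons-zero _ v ; (suc h) → ≡.trans (cons-suc _ v h) (v≐u h) })
                         (sym (on _ cons-u))

  -- The constructor used by allPt is local to Defs; unification recovers it from the goal.
  allPt-enumeratesOnce : ∀ n m → EnumeratesOnce (allPt n m)
  allPt-enumeratesOnce zero    m u f off on = trans (+-identityʳ _) (on _ (λ ()))
  allPt-enumeratesOnce (suc n) m =
    enumeratesOnce-concatMap _ (λ _ _ → ≡.refl) (λ _ _ _ → ≡.refl) (allPt-enumeratesOnce n _)

  bools : List Bool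
  bools = false ∷ true ∷ []

  ∑-bools-support : ∀ b (g : Bool → Carrier) → (∀ b′ → b′ ≢ b → g b′ ≈ 0#) → ∑ bools g ≈ g b
  ∑-bools-support false g off = trans (+-cong refl (trans (+-identityʳ _) (off true λ ()))) (+-identityʳ _)
  ∑-bools-support true  g off = trans (+-cong (off false λ ()) (+-identityʳ _)) (+-identityˡ _)

  ∑-allBits-suc : ∀ n (f : Bits (suc n) → Carrier) →
                  ∑ (allBits (suc n)) f ≈ ∑ (allBits n) (λ v → ∑ bools (λ b → f (b ∷ᵥ v)))
  ∑-allBits-suc n f = ∑-concatMap _ (allBits n) f

  ∑-allBits-support : ∀ n (s : Bits n) (f : Bits n → Carrier) → (∀ v → v ≢ s → f v ≈ 0#) →
                      ∑ (allBits n) f ≈ f s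
  ∑-allBits-support zero    []ᵥ      f off = +-identityʳ _
  ∑-allBits-support (suc n) (b ∷ᵥ s) f off = begin
    ∑ (allBits (suc n)) f                               ≈⟨ ∑-allBits-suc n f ⟩
    ∑ (allBits n) (λ v → ∑ bools (λ b′ → f (b′ ∷ᵥ v))) ≈⟨ ∑-cong (allBits n) first-bit ⟩
    ∑ (allBits n) (λ v → f (b ∷ᵥ v))                    ≈⟨ ∑-allBits-support n s _ rest-bits ⟩
    f (b ∷ᵥ s)                                          ∎
    where
    first-bit : ∀ v → ∑ bools (λ b′ → f (b′ ∷ᵥ v)) ≈ f (b ∷ᵥ v)
    first-bit v = ∑-bools-support b _ (λ b′ b′≢b → off _ (b′≢b ∘ Vecₚ.∷-injectiveˡ))

    rest-bits : ∀ v → v ≢ s → f (b ∷ᵥ v) ≈ 0#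
    rest-bits v v≢s = off _ (v≢s ∘ Vecₚ.∷-injectiveʳ)

  ∑³ : ∀ n → (Bits n × Bits n × Bits n → Carrier) → Carrier
  ∑³ n F = ∑ (allBits n) λ a → ∑ (allBits n) λ b → ∑ (allBits n) λ c → F (a , b , c)

  ∑-allTriples : ∀ n F → ∑ (allTriples n) F ≈ ∑³ n F
  ∑-allTriples n F =
    trans (∑-concatMap _ (allBits n) F)
          (∑-cong (allBits n) λ a → trans (∑-concatMap _ (allBits n) F)
                                          (∑-cong (allBits n) λ b → ∑-map _ (allBits n) F))

  ∑³-support : ∀ n t (F : Bits n × Bits n × Bits n → Carrier) → (∀ t′ → t′ ≢ t → F t′ ≈ 0#) →
               ∑³ n F ≈ F t
  ∑³-support n (a , b , c) F off =
    trans (∑-allBits-support n a _ λ a′ a′≢a → ∑-zero (allBits n) λ b′ → ∑-zero (allBits n) λ c′ →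
             off _ (a′≢a ∘ ≡.cong proj₁))
    (trans (∑-allBits-support n b _ λ b′ b′≢b → ∑-zero (allBits n) λ c′ →
              off _ (b′≢b ∘ ≡.cong (proj₁ ∘ proj₂)))
           (∑-allBits-support n c _ λ c′ c′≢c → off _ (c′≢c ∘ ≡.cong (proj₂ ∘ proj₂))))

  ∑³-suc : ∀ n F → ∑³ (suc n) F ≈
    ∑ bools λ a₀ → ∑ bools λ b₀ → ∑ bools λ c₀ → ∑³ n λ (a , b , c) → F (a₀ ∷ᵥ a , b₀ ∷ᵥ b , c₀ ∷ᵥ c)
  ∑³-suc n F = begin
    ∑³ (suc n) F
      ≈⟨ split-first-bits ⟩
    (∑ L λ a → ∑ bools λ a₀ → ∑ L λ b → ∑ bools λ b₀ → ∑ L λ c → ∑ bools λ c₀ → F′ a₀ b₀ c₀ a b c)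
      ≈⟨ ∑-swap L bools (λ a a₀ → ∑ L λ b → ∑ bools λ b₀ → ∑ L λ c → ∑ bools λ c₀ → F′ a₀ b₀ c₀ a b c) ⟩
    (∑ bools λ a₀ → ∑ L λ a → ∑ L λ b → ∑ bools λ b₀ → ∑ L λ c → ∑ bools λ c₀ → F′ a₀ b₀ c₀ a b c)
      ≈⟨ ∑-cong bools (λ a₀ → trans (pull-through-two λ a b b₀ → ∑ L λ c → ∑ bools λ c₀ → F′ a₀ b₀ c₀ a b c)
                                     (∑-cong bools λ b₀ → pull-through-three λ a b c c₀ → F′ a₀ b₀ c₀ a b c)) ⟩
    (∑ bools λ a₀ → ∑ bools λ b₀ → ∑ bools λ c₀ → ∑ L λ a → ∑ L λ b → ∑ L λ c → F′ a₀ b₀ c₀ a b c)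
      ∎
    where
    L = allBits n
    L′ = allBits (suc n)

    F′ : Bool → Bool → Bool → Bits n → Bits n → Bits n → Carrier
    F′ a₀ b₀ c₀ a b c = F (a₀ ∷ᵥ a , b₀ ∷ᵥ b , c₀ ∷ᵥ c)

    split-first-bits :
      ∑³ (suc n) F ≈ (∑ L λ a → ∑ bools λ a₀ → ∑ L λ b → ∑ bools λ b₀ → ∑ L λ c → ∑ bools λ c₀ → F′ a₀ b₀ c₀ a b c)
    split-first-bits =
      trans (∑-allBits-suc n λ a → ∑ L′ λ b → ∑ L′ λ c → F (a , b , c)) (∑-cong L λ a → ∑-cong bools λ a₀ →
      trans (∑-allBits-suc n λ b → ∑ L′ λ c → F (a₀ ∷ᵥ a , b , c)) (∑-cong L λ b → ∑-cong bools λ b₀ →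
      ∑-allBits-suc n λ c → F (a₀ ∷ᵥ a , b₀ ∷ᵥ b , c)))

    pull-through-two : ∀ (G : Bits n → Bits n → Bool → Carrier) →
      (∑ L λ a → ∑ L λ b → ∑ bools (G a b)) ≈ (∑ bools λ t → ∑ L λ a → ∑ L λ b → G a b t)
    pull-through-two G =
      trans (∑-cong L λ a → ∑-swap L bools (G a)) (∑-swap L bools λ a t → ∑ L λ b → G a b t)

    pull-through-three : ∀ (G : Bits n → Bits n → Bits n → Bool → Carrier) →
      (∑ L λ a → ∑ L λ b → ∑ L λ c → ∑ bools (G a b c)) ≈ (∑ bools λ t → ∑ L λ a → ∑ L λ b → ∑ L λ c → G a b c t)
    pull-through-three G =
      trans (∑-cong L λ a → pull-through-two (G a)) (∑-swap L bools λ a t → ∑ L λ b → ∑ L λ c → G a b c t)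

T-injective : ∀ {x y} → (T x ⇔ T y) → x ≡ y
T-injective {false} {false} _   = ≡.refl
T-injective {false} {true}  x⇔y = ⊥-elim (from x⇔y _)
T-injective {true}  {false} x⇔y = ⊥-elim (to x⇔y _)
T-injective {true}  {true}  _   = ≡.refl

T-allᵇ : ∀ n (p : Fin n → Bool) → T (allᵇ n p) ⇔ (∀ a → T (p a))
T-allᵇ n p = mk⇔ (λ t a → All.lookup (Allₚ.all⁺ p (allFin n) t) (∈-allFin a))
                 (λ all-p → Allₚ.all⁻ p (Allₚ.tabulate⁺ all-p))

allᵇ-suc : ∀ n (p : Fin (suc n) → Bool) → allᵇ (suc n) p ≡ p zero ∧ allᵇ n (p ∘ suc)
allᵇ-suc n p = ≡.cong (λ l → p zero ∧ List.foldr _∧_ true l)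
  (≡.trans (Listₚ.map-tabulate suc p) (≡.sym (Listₚ.map-tabulate id (p ∘ suc))))

⇔⇒isYes-≡ : ∀ {a b} {A : Set a} {B : Set b} → A ⇔ B → (a? : Dec A) (b? : Dec B) → ⌊ a? ⌋ ≡ ⌊ b? ⌋
⇔⇒isYes-≡ A⇔B a? b? = ≡.trans (isYes≗does a?) (≡.trans (does-⇔ A⇔B a? b?) (≡.sym (isYes≗does b?)))

isYes-≡⇒⇔ : ∀ {a b} {A : Set a} {B : Set b} (a? : Dec A) (b? : Dec B) → ⌊ a? ⌋ ≡ ⌊ b? ⌋ → A ⇔ B
isYes-≡⇒⇔ a? b? eq = mk⇔ (λ a → toWitness (≡.subst T eq (fromWitness a)))
                         (λ b → toWitness (≡.subst T (≡.sym eq) (fromWitness b)))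

≡-tabulate⇔ : ∀ {a} {A : Set a} {k} (v : Vec A k) (f : Fin k → A) →
              (v ≡ Vec.tabulate f) ⇔ (∀ i → lookup v i ≡ f i)
≡-tabulate⇔ v f = mk⇔ (λ v≡ i → ≡.trans (≡.cong (λ w → lookup w i) v≡) (Vecₚ.lookup∘tabulate f i))
                      (λ v≗f → ≡.trans (≡.sym (Vecₚ.tabulate∘lookup v)) (Vecₚ.tabulate-cong v≗f))

_≠ᵇ_ : ∀ {k} → Fin k → Fin k → Bool
p ≠ᵇ q = not ⌊ p Fin.≟ q ⌋

≠ᵇ-refl : ∀ {k} (p : Fin k) → p ≠ᵇ p ≡ false
≠ᵇ-refl p with p Fin.≟ p
... | yes _   = ≡.refl
... | no  p≢p = ⊥-elim (p≢p ≡.refl)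

≢⇒≠ᵇ : ∀ {k} {p q : Fin k} → p ≢ q → p ≠ᵇ q ≡ true
≢⇒≠ᵇ {p = p} {q} p≢q with p Fin.≟ q
... | yes p≡q = ⊥-elim (p≢q p≡q)
... | no  _   = ≡.refl

≠ᵇ≡false⇔ : ∀ {k} (p q : Fin k) → (p ≠ᵇ q ≡ false) ⇔ p ≡ q
≠ᵇ≡false⇔ p q with p Fin.≟ q
... | yes p≡q = mk⇔ (λ _ → p≡q) (λ _ → ≡.refl)
... | no  p≢q = mk⇔ (λ ()) (⊥-elim ∘ p≢q)

pairwise-distinct⇒2< : ∀ {k} (p q r : Fin k) → p ≢ q → q ≢ r → p ≢ r → 2 ℕ.< k
pairwise-distinct⇒2< {suc (suc (suc _))} _ _ _ _ _ _ = ℕ.s≤s (ℕ.s≤s (ℕ.s≤s ℕ.z≤n))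
pairwise-distinct⇒2< {1} zero       zero       _          p≢q _   _   = ⊥-elim (p≢q ≡.refl)
pairwise-distinct⇒2< {2} zero       zero       _          p≢q _   _   = ⊥-elim (p≢q ≡.refl)
pairwise-distinct⇒2< {2} (suc zero) (suc zero) _          p≢q _   _   = ⊥-elim (p≢q ≡.refl)
pairwise-distinct⇒2< {2} zero       (suc zero) zero       _   _   p≢r = ⊥-elim (p≢r ≡.refl)
pairwise-distinct⇒2< {2} zero       (suc zero) (suc zero) _   q≢r _   = ⊥-elim (q≢r ≡.refl)
pairwise-distinct⇒2< {2} (suc zero) zero       zero       _   q≢r _   = ⊥-elim (q≢r ≡.refl)
pairwise-distinct⇒2< {2} (suc zero) zero       (suc zero) _   _   p≢r = ⊥-elim (p≢r ≡.refl)

another : ∀ {k} → Fin k → Fin k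
another {suc (suc _)} zero    = suc zero
another {suc (suc _)} (suc _) = zero
another               p       = p

another-≢ : ∀ {k} → 2 ℕ.≤ k → (p : Fin k) → p ≢ another p
another-≢ {suc (suc _)} _          zero    ()
another-≢ {suc (suc _)} _          (suc _) ()
another-≢ {suc zero}    (ℕ.s≤s ()) _

third : ∀ {k} → Fin k → Fin k
third {suc (suc (suc _))} zero          = suc (suc zero)
third {suc (suc (suc _))} (suc zero)    = suc (suc zero)
third {suc (suc (suc _))} (suc (suc _)) = suc zero
third                     p             = p

third-≢ : ∀ {k} → 2 ℕ.< k → (p : Fin k) → p ≢ third p × another p ≢ third p
third-≢ {suc (suc (suc _))} _                  zero          = (λ ()) , (λ ())
third-≢ {suc (suc (suc _))} _                  (suc zero)    = (λ ()) , (λ ())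
third-≢ {suc (suc (suc _))} _                  (suc (suc _)) = (λ ()) , (λ ())
third-≢ {suc zero}          (ℕ.s≤s ())         _
third-≢ {suc (suc zero)}    (ℕ.s≤s (ℕ.s≤s ())) _

-- inℙᵇ m a b c unfolds to allᵇ n (λ h → inℙ₁ᵇ (lookup a h) (lookup b h) (lookup c h) (bigᵇ m h)).
inℙ₁ᵇ : Bool → Bool → Bool → Bool → Bool
inℙ₁ᵇ a b c big = (not (a xor c) ∨ b) ∧ (not b ∨ ((a xor c) ∨ (a ∧ c ∧ big)))

module Coordinate {k : ℕ} where

  ⟨$⟩ʳ-injective : ∀ (π : Permutation′ k) {u v} → π ⟨$⟩ʳ u ≡ π ⟨$⟩ʳ v → u ≡ v
  ⟨$⟩ʳ-injective π eq = ≡.trans (≡.sym (inverseˡ π)) (≡.trans (≡.cong (Inverse.from π) eq) (inverseˡ π))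

  transpose-maps : ∀ (i j : Fin k) → transpose i j ⟨$⟩ʳ i ≡ j
  transpose-maps i j rewrite dec-true (i Fin.≟ i) ≡.refl = ≡.refl

  transpose-fixes : ∀ {i j q : Fin k} → (q ≡ i ⇔ q ≡ j) → transpose i j ⟨$⟩ʳ q ≡ q
  transpose-fixes {i} {j} {q} q≡i⇔q≡j with q Fin.≟ i
  ... | yes q≡i = ≡.sym (to q≡i⇔q≡j q≡i)
  ... | no  q≢i rewrite dec-false (q Fin.≟ j) (q≢i ∘ from q≡i⇔q≡j) = ≡.refl

  -- First swap y with y′, then the image of z with z′; the hypotheses say that neither swap
  -- moves p, and that the second one does not move y′.
  matching-permutation : ∀ {p y z y′ z′ : Fin k} →
    (p ≡ y ⇔ p ≡ y′) → (y ≡ z ⇔ y′ ≡ z′) → (p ≡ z ⇔ p ≡ z′) →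
    Σ (Permutation′ k) λ π → π ⟨$⟩ʳ p ≡ p × π ⟨$⟩ʳ y ≡ y′ × π ⟨$⟩ʳ z ≡ z′
  matching-permutation {p} {y} {z} {y′} {z′} p≡y⇔ y≡z⇔ p≡z⇔ =
    t₁ ∘ₚ t₂ , fixes-p , maps-y , transpose-maps (t₁ ⟨$⟩ʳ z) z′
    where
    t₁ = transpose y y′
    t₂ = transpose (t₁ ⟨$⟩ʳ z) z′

    t₁-preserves-≡z : ∀ {u w} → t₁ ⟨$⟩ʳ w ≡ u → (u ≡ t₁ ⟨$⟩ʳ z ⇔ w ≡ z)
    t₁-preserves-≡z t₁w≡u = mk⇔ (λ u≡ → ⟨$⟩ʳ-injective t₁ (≡.trans t₁w≡u u≡))
                               (λ w≡z → ≡.trans (≡.sym t₁w≡u) (≡.cong (t₁ ⟨$⟩ʳ_) w≡z))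

    t₁-fixes-p : t₁ ⟨$⟩ʳ p ≡ p
    t₁-fixes-p = transpose-fixes p≡y⇔

    fixes-p : t₂ ⟨$⟩ʳ (t₁ ⟨$⟩ʳ p) ≡ p
    fixes-p = ≡.trans (≡.cong (t₂ ⟨$⟩ʳ_) t₁-fixes-p)
                      (transpose-fixes (⇔-trans (t₁-preserves-≡z t₁-fixes-p) p≡z⇔))

    maps-y : t₂ ⟨$⟩ʳ (t₁ ⟨$⟩ʳ y) ≡ y′
    maps-y = ≡.trans (≡.cong (t₂ ⟨$⟩ʳ_) (transpose-maps y y′))
                     (transpose-fixes (⇔-trans (t₁-preserves-≡z (transpose-maps y y′)) y≡z⇔))

  pattern-inℙ₁ : ∀ (p q r : Fin k) → T (inℙ₁ᵇ (p ≠ᵇ q) (q ≠ᵇ r) (p ≠ᵇ r) ⌊ 2 ℕ.<? k ⌋)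
  pattern-inℙ₁ p q r with p Fin.≟ q | q Fin.≟ r | p Fin.≟ r
  ... | yes p≡q | yes q≡r | no  p≢r = p≢r (≡.trans p≡q q≡r)
  ... | yes p≡q | no  q≢r | yes p≡r = q≢r (≡.trans (≡.sym p≡q) p≡r)
  ... | no  p≢q | yes q≡r | yes p≡r = p≢q (≡.trans p≡r (≡.sym q≡r))
  ... | no  p≢q | no  q≢r | no  p≢r = fromWitness (pairwise-distinct⇒2< p q r p≢q q≢r p≢r)
  ... | yes _   | yes _   | yes _   = _
  ... | yes _   | no  _   | no  _   = _
  ... | no  _   | yes _   | no  _   = _
  ... | no  _   | no  _   | yes _   = _

  witnessʸ : Bool → Fin k → Fin k
  witnessʸ a p = if a then another p else p

  witnessᶻ : Bool → Bool → Bool → Fin k → Fin k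
  witnessᶻ a b c p = if c then (if a ∧ b then third p else another p) else p

  witness-pattern : 2 ℕ.≤ k → ∀ p a b c → T (inℙ₁ᵇ a b c ⌊ 2 ℕ.<? k ⌋) →
    p ≠ᵇ witnessʸ a p ≡ a × witnessʸ a p ≠ᵇ witnessᶻ a b c p ≡ b × p ≠ᵇ witnessᶻ a b c p ≡ c
  witness-pattern 2≤k p false false false _ = ≠ᵇ-refl p , ≠ᵇ-refl p , ≠ᵇ-refl p
  witness-pattern 2≤k p false true  true  _ =
    ≠ᵇ-refl p , ≢⇒≠ᵇ (another-≢ 2≤k p) , ≢⇒≠ᵇ (another-≢ 2≤k p)
  witness-pattern 2≤k p true  false true  _ =
    ≢⇒≠ᵇ (another-≢ 2≤k p) , ≠ᵇ-refl (another p) , ≢⇒≠ᵇ (another-≢ 2≤k p)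
  witness-pattern 2≤k p true  true  false _ =
    ≢⇒≠ᵇ (another-≢ 2≤k p) , ≢⇒≠ᵇ (another-≢ 2≤k p ∘ ≡.sym) , ≠ᵇ-refl p
  witness-pattern 2≤k p true  true  true  2<k =
    ≢⇒≠ᵇ (another-≢ 2≤k p) , ≢⇒≠ᵇ (proj₂ (third-≢ (toWitness 2<k) p)) ,
    ≢⇒≠ᵇ (proj₁ (third-≢ (toWitness 2<k) p))

module Terwilliger {c ℓ} (𝔽 : Field c ℓ) (n : ℕ) (m : Fin n → ℕ) where
  open Field 𝔽 hiding (zero)
  open Matrices 𝔽 n m
  open ListSum commutativeSemiring
  open import Relation.Binary.Reasoning.Setoid setoid

  [_] : Bool → Carrier
  [ b ] = if b then 1# else 0#

  [∧] : ∀ p q → [ p ∧ q ] ≈ [ p ] * [ q ]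
  [∧] true  q = sym (*-identityˡ _)
  [∧] false q = sym (zeroˡ _)

  _≟ᵇ_ : (g h : Bits n) → Dec (g ≡ h)
  _≟ᵇ_ = Vecₚ.≡-dec Bool._≟_

  rel : Pt n m → Pt n m → Bits n
  rel u v = Vec.tabulate (λ a → u a ≠ᵇ v a)

  lookup-rel : ∀ u v h → lookup (rel u v) h ≡ u h ≠ᵇ v h
  lookup-rel u v h = Vecₚ.lookup∘tabulate _ h

  rel-cong : ∀ {u u′ v v′} → u ≐ u′ → v ≐ v′ → rel u v ≡ rel u′ v′
  rel-cong u≐u′ v≐v′ = Vecₚ.tabulate-cong (λ a → ≡.cong₂ _≠ᵇ_ (u≐u′ a) (v≐v′ a))

  rel-≡⇒⇔ : ∀ {u v u′ v′} → rel u v ≡ rel u′ v′ → ∀ h → (u h ≡ v h ⇔ u′ h ≡ v′ h)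
  rel-≡⇒⇔ {u} {v} {u′} {v′} eq h = isYes-≡⇒⇔ (u h Fin.≟ v h) (u′ h Fin.≟ v′ h) (Boolₚ.not-injective
    (≡.trans (≡.sym (lookup-rel u v h)) (≡.trans (≡.cong (λ r → lookup r h) eq) (lookup-rel u′ v′ h))))

  T-inRᵇ : ∀ g u v → T (inRᵇ g u v) ⇔ g ≡ rel u v
  T-inRᵇ g u v =
    ⇔-trans (T-allᵇ n _)
            (⇔-trans (mk⇔ (λ t a → ≡.sym (toWitness (t a))) (λ eq a → fromWitness (≡.sym (eq a))))
                     (⇔-sym (≡-tabulate⇔ g _)))

  inRᵇ-rel : ∀ g u v → inRᵇ g u v ≡ does (g ≟ᵇ rel u v)
  inRᵇ-rel g u v = ≡.trans (T-injective (⇔-trans (T-inRᵇ g u v) (mk⇔ fromWitness toWitness)))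
                           (isYes≗does (g ≟ᵇ rel u v))

  inRᵇ-cong : ∀ g {u u′ v v′} → u ≐ u′ → v ≐ v′ → inRᵇ g u v ≡ inRᵇ g u′ v′
  inRᵇ-cong g {u} {u′} {v} {v′} u≐u′ v≐v′ =
    ≡.trans (inRᵇ-rel g u v)
            (≡.trans (≡.cong (λ r → does (g ≟ᵇ r)) (rel-cong u≐u′ v≐v′)) (≡.sym (inRᵇ-rel g u′ v′)))

  T-eqᵇ : ∀ u v → T (eqᵇ u v) ⇔ u ≐ v
  T-eqᵇ u v = ⇔-trans (T-allᵇ n _) (mk⇔ (λ t a → toWitness (t a)) (λ u≐v a → fromWitness (u≐v a)))

  eqᵇ-sym : ∀ u v → eqᵇ u v ≡ eqᵇ v u
  eqᵇ-sym u v = T-injective (⇔-trans (T-eqᵇ u v)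
    (⇔-trans (mk⇔ ≐-sym ≐-sym) (⇔-sym (T-eqᵇ v u))))

  zeros : Bits n
  zeros = Vec.replicate n false

  eqᵇ-rel : ∀ u v → eqᵇ u v ≡ does (zeros ≟ᵇ rel u v)
  eqᵇ-rel u v =
    ≡.trans (T-injective (⇔-trans (T-eqᵇ u v) (⇔-trans ≐⇔zeros (mk⇔ fromWitness toWitness))))
            (isYes≗does (zeros ≟ᵇ rel u v))
    where
    ≐⇔zeros : u ≐ v ⇔ zeros ≡ rel u v
    ≐⇔zeros = ⇔-trans
      (mk⇔ (λ u≐v a → ≡.trans (Vecₚ.lookup-replicate a false) (≡.sym (from (≠ᵇ≡false⇔ (u a) (v a)) (u≐v a))))
           (λ z a → to (≠ᵇ≡false⇔ (u a) (v a)) (≡.trans (≡.sym (z a)) (Vecₚ.lookup-replicate a false))))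
      (⇔-sym (≡-tabulate⇔ zeros _))

  ∑-δ : ∀ u (g : Pt n m → Carrier) → (∀ v → v ≐ u → g v ≈ g u) →
        ∑ (allPt n m) (λ v → [ eqᵇ u v ] * g v) ≈ g u
  ∑-δ u g g-resp =
    trans (allPt-enumeratesOnce n m u (λ v → [ eqᵇ u v ] * g v) off on)
          (trans (*-cong (indicator u ≐-refl) refl) (*-identityˡ _))
    where
    indicator : ∀ v → v ≐ u → [ eqᵇ u v ] ≈ 1#
    indicator v v≐u = reflexive (≡.cong [_] (to Boolₚ.T-≡ (from (T-eqᵇ u v) (≐-sym v≐u))))

    off : ∀ v → ¬ v ≐ u → [ eqᵇ u v ] * g v ≈ 0#
    off v v≉u with eqᵇ u v in eq
    ... | true  = ⊥-elim (v≉u (≐-sym (to (T-eqᵇ u v) (from Boolₚ.T-≡ eq))))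
    ... | false = zeroˡ _

    on : ∀ v → v ≐ u → [ eqᵇ u v ] * g v ≈ [ eqᵇ u u ] * g u
    on v v≐u = *-cong (trans (indicator v v≐u) (sym (indicator u ≐-refl))) (g-resp v v≐u)

  E*-*ₘ : ∀ x a (M : Mat) y z → (∀ w → w ≐ y → M w z ≈ M y z) →
          (E* x a *ₘ M) y z ≈ [ inRᵇ a x y ] * M y z
  E*-*ₘ x a M y z M-resp = begin
    ∑ (allPt n m) (λ w → [ eqᵇ y w ∧ inRᵇ a x y ] * M w z)
      ≈⟨ ∑-cong (allPt n m) (λ w → trans (*-cong ([∧] (eqᵇ y w) _) refl) (*-assoc _ _ _)) ⟩
    ∑ (allPt n m) (λ w → [ eqᵇ y w ] * ([ inRᵇ a x y ] * M w z))
      ≈⟨ ∑-δ y _ (λ w w≐y → *-cong refl (M-resp w w≐y)) ⟩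
    [ inRᵇ a x y ] * M y z ∎

  *ₘ-E* : ∀ x c (M : Mat) y z → (∀ w → w ≐ z → M y w ≈ M y z) →
          (M *ₘ E* x c) y z ≈ M y z * [ inRᵇ c x z ]
  *ₘ-E* x c M y z M-resp = begin
    ∑ (allPt n m) (λ w → M y w * [ eqᵇ w z ∧ inRᵇ c x w ])
      ≈⟨ ∑-cong (allPt n m) (λ w → trans (*-comm _ _) (trans (*-cong (diagonal w) refl) (*-assoc _ _ _))) ⟩
    ∑ (allPt n m) (λ w → [ eqᵇ z w ] * ([ inRᵇ c x w ] * M y w))
      ≈⟨ ∑-δ z _ (λ w w≐z → *-cong (reflexive (≡.cong [_] (inRᵇ-cong c ≐-refl w≐z))) (M-resp w w≐z)) ⟩
    [ inRᵇ c x z ] * M y z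
      ≈⟨ *-comm _ _ ⟩
    M y z * [ inRᵇ c x z ] ∎
    where
    diagonal : ∀ w → [ eqᵇ w z ∧ inRᵇ c x w ] ≈ [ eqᵇ z w ] * [ inRᵇ c x w ]
    diagonal w = trans (reflexive (≡.cong (λ e → [ e ∧ _ ]) (eqᵇ-sym w z))) ([∧] (eqᵇ z w) _)

  permute : ((h : Fin n) → Permutation′ (m h)) → Pt n m → Pt n m
  permute π u h = π h ⟨$⟩ʳ u h

  ∑-permute : ∀ π (F : Pt n m → Carrier) → (∀ v w → v ≐ w → F v ≈ F w) →
              ∑ (allPt n m) F ≈ ∑ (allPt n m) (F ∘ permute π)
  ∑-permute π F F-resp = sym (begin
    ∑ (allPt n m) (F ∘ permute π)
      ≈⟨ ∑-cong (allPt n m) (λ w → sym (∑-δ (permute π w) F (λ v v≐ → F-resp v _ v≐))) ⟩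
    (∑ (allPt n m) λ w → ∑ (allPt n m) λ v → [ eqᵇ (permute π w) v ] * F v)
      ≈⟨ ∑-swap (allPt n m) (allPt n m) _ ⟩
    (∑ (allPt n m) λ v → ∑ (allPt n m) λ w → [ eqᵇ (permute π w) v ] * F v)
      ≈⟨ ∑-cong (allPt n m) (λ v → ∑-cong (allPt n m) λ w →
           reflexive (≡.cong (λ e → [ e ] * F v) (moved⇔unmoved w v))) ⟩
    (∑ (allPt n m) λ v → ∑ (allPt n m) λ w → [ eqᵇ (unpermute v) w ] * F v)
      ≈⟨ ∑-cong (allPt n m) (λ v → ∑-δ (unpermute v) (λ _ → F v) (λ _ _ → refl)) ⟩
    ∑ (allPt n m) F ∎)
    where
    unpermute : Pt n m → Pt n m
    unpermute u h = π h ⟨$⟩ˡ u h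

    moved⇔unmoved : ∀ w v → eqᵇ (permute π w) v ≡ eqᵇ (unpermute v) w
    moved⇔unmoved w v = T-injective (⇔-trans (T-eqᵇ _ v) (⇔-trans
      (mk⇔ (λ πw≐v h → ≡.trans (≡.cong (π h ⟨$⟩ˡ_) (≡.sym (πw≐v h))) (inverseˡ (π h)))
           (λ π⁻¹v≐w h → ≡.trans (≡.cong (π h ⟨$⟩ʳ_) (≡.sym (π⁻¹v≐w h))) (inverseʳ (π h))))
      (⇔-sym (T-eqᵇ _ w))))

  rel-permute : ∀ π u v → rel (permute π u) (permute π v) ≡ rel u v
  rel-permute π u v = Vecₚ.tabulate-cong λ h → ≡.cong not
    (⇔⇒isYes-≡ (mk⇔ (Coordinate.⟨$⟩ʳ-injective (π h)) (≡.cong (π h ⟨$⟩ʳ_))) (_ Fin.≟ _) (_ Fin.≟ _))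

  module BasePoint (x : Pt n m) where

    rel³ : Pt n m → Pt n m → Triple
    rel³ y z = rel x y , rel y z , rel x z

    _≟³_ : (s t : Triple) → Dec (s ≡ t)
    (a , b , c) ≟³ (a′ , b′ , c′) =
      map′ (λ { (≡.refl , ≡.refl , ≡.refl) → ≡.refl }) (λ { ≡.refl → ≡.refl , ≡.refl , ≡.refl })
           ((a ≟ᵇ a′) ×-dec (b ≟ᵇ b′) ×-dec (c ≟ᵇ c′))

    E*A-entry : ∀ a b y z → (E* x a *ₘ A b) y z ≈ [ inRᵇ a x y ] * [ inRᵇ b y z ]
    E*A-entry a b y z =
      E*-*ₘ x a (A b) y z (λ w w≐y → reflexive (≡.cong [_] (inRᵇ-cong b w≐y ≐-refl)))

    basisElt-rel³ : ∀ t y z → basisElt x t y z ≈ [ does (t ≟³ rel³ y z) ]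
    basisElt-rel³ (a , b , c) y z = begin
      ((E* x a *ₘ A b) *ₘ E* x c) y z
        ≈⟨ *ₘ-E* x c (E* x a *ₘ A b) y z E*A-resp ⟩
      (E* x a *ₘ A b) y z * [ inRᵇ c x z ]
        ≈⟨ *-cong (E*A-entry a b y z) refl ⟩
      ([ inRᵇ a x y ] * [ inRᵇ b y z ]) * [ inRᵇ c x z ]
        ≈⟨ *-assoc _ _ _ ⟩
      [ inRᵇ a x y ] * ([ inRᵇ b y z ] * [ inRᵇ c x z ])
        ≡⟨ ≡.cong₂ (λ p q → [ p ] * q) (inRᵇ-rel a x y)
                   (≡.cong₂ (λ p q → [ p ] * [ q ]) (inRᵇ-rel b y z) (inRᵇ-rel c x z)) ⟩
      [ does (a ≟ᵇ rel x y) ] * ([ does (b ≟ᵇ rel y z) ] * [ does (c ≟ᵇ rel x z) ])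
        ≈⟨ trans ([∧] _ _) (*-cong refl ([∧] _ _)) ⟨
      [ does ((a , b , c) ≟³ rel³ y z) ] ∎
      where
      E*A-resp : ∀ w → w ≐ z → (E* x a *ₘ A b) y w ≈ (E* x a *ₘ A b) y z
      E*A-resp w w≐z = trans (E*A-entry a b y w)
        (trans (*-cong refl (reflexive (≡.cong [_] (inRᵇ-cong b ≐-refl w≐z)))) (sym (E*A-entry a b y z)))

    rel³-inℙ : ∀ y z → Inℙ m (rel x y) (rel y z) (rel x z)
    rel³-inℙ y z = from (T-allᵇ n _) coordinate
      where
      coordinate : ∀ h → T (inℙ₁ᵇ (lookup (rel x y) h) (lookup (rel y z) h) (lookup (rel x z) h) (bigᵇ m h))
      coordinate h rewrite lookup-rel x y h | lookup-rel y z h | lookup-rel x z h =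
        Coordinate.pattern-inℙ₁ (x h) (y h) (z h)

    foldr-basisElt-entry : ∀ (κ : Triple → Carrier) (ts : List Triple) y z →
      List.foldr (λ t M → (κ t ·ₘ basisElt x t) +ₘ M) 0ₘ ts y z ≈ ∑ ts (λ t → κ t * basisElt x t y z)
    foldr-basisElt-entry κ []       y z = refl
    foldr-basisElt-entry κ (t ∷ ts) y z = +-cong refl (foldr-basisElt-entry κ ts y z)

    comb-rel³ : ∀ (κ : Triple → Carrier) y z → comb x κ y z ≈ κ (rel³ y z)
    comb-rel³ κ y z = begin
      comb x κ y z                                   ≈⟨ foldr-basisElt-entry κ ℙlist y z ⟩
      ∑ ℙlist (λ t → κ t * basisElt x t y z)        ≈⟨ ∑-cong ℙlist (λ t → *-cong refl (basisElt-rel³ t y z)) ⟩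
      ∑ ℙlist (λ t → κ t * [ does (t ≟³ rel³ y z) ]) ≈⟨ ∑-filter _ (allTriples n) _ ⟩
      ∑ (allTriples n) summand                       ≈⟨ ∑-allTriples n summand ⟩
      ∑³ n summand                                   ≈⟨ ∑³-support n (rel³ y z) summand off ⟩
      summand (rel³ y z)                             ≈⟨ on ⟩
      κ (rel³ y z)                                   ∎
      where
      summand : Triple → Carrier
      summand (a , b , c) = if inℙᵇ m a b c then κ (a , b , c) * [ does ((a , b , c) ≟³ rel³ y z) ] else 0#

      off : ∀ t → t ≢ rel³ y z → summand t ≈ 0#
      off (a , b , c) t≢ with inℙᵇ m a b c
      ... | true  = trans (*-cong refl (reflexive (≡.cong [_] (dec-false ((a , b , c) ≟³ rel³ y z) t≢)))) (zeroʳ _)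
      ... | false = refl

      on : summand (rel³ y z) ≈ κ (rel³ y z)
      on rewrite to Boolₚ.T-≡ (rel³-inℙ y z) | dec-true (rel³ y z ≟³ rel³ y z) ≡.refl = *-identityʳ _

    stabiliser-transitive : ∀ {y z y′ z′} → rel³ y z ≡ rel³ y′ z′ →
      Σ ((h : Fin n) → Permutation′ (m h)) λ π → permute π x ≐ x × permute π y ≐ y′ × permute π z ≐ z′
    stabiliser-transitive eq =
      proj₁ ∘ matching , proj₁ ∘ proj₂ ∘ matching ,
      proj₁ ∘ proj₂ ∘ proj₂ ∘ matching , proj₂ ∘ proj₂ ∘ proj₂ ∘ matching
      where
      matching = λ h → Coordinate.matching-permutation (rel-≡⇒⇔ (≡.cong proj₁ eq) h)
                         (rel-≡⇒⇔ (≡.cong (proj₁ ∘ proj₂) eq) h) (rel-≡⇒⇔ (≡.cong (proj₂ ∘ proj₂) eq) h)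

    convolution : (κ κ′ : Triple → Carrier) → Pt n m → Pt n m → Carrier
    convolution κ κ′ y z = ∑ (allPt n m) (λ w → κ (rel³ y w) * κ′ (rel³ w z))

    convolution-invariant : ∀ κ κ′ {y z y′ z′} → rel³ y z ≡ rel³ y′ z′ →
                            convolution κ κ′ y z ≈ convolution κ κ′ y′ z′
    convolution-invariant κ κ′ {y} {z} {y′} {z′} eq with stabiliser-transitive eq
    ... | π , πx≐x , πy≐y′ , πz≐z′ = sym (begin
      convolution κ κ′ y′ z′
        ≈⟨ ∑-permute π _ summand-resp ⟩
      ∑ (allPt n m) (λ w → κ (rel³ y′ (permute π w)) * κ′ (rel³ (permute π w) z′))
        ≈⟨ ∑-cong (allPt n m) (λ w → reflexive (moved w)) ⟩
      convolution κ κ′ y z ∎)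
      where
      summand-resp : ∀ v w → v ≐ w → κ (rel³ y′ v) * κ′ (rel³ v z′) ≈ κ (rel³ y′ w) * κ′ (rel³ w z′)
      summand-resp v w v≐w = reflexive (≡.cong₂ _*_
        (≡.cong κ (≡.cong₂ (λ p q → rel x y′ , p , q) (rel-cong ≐-refl v≐w) (rel-cong ≐-refl v≐w)))
        (≡.cong κ′ (≡.cong₂ (λ p q → p , q , rel x z′) (rel-cong ≐-refl v≐w) (rel-cong v≐w ≐-refl))))

      rel-from : ∀ {u u′} → permute π u ≐ u′ → ∀ w → rel u′ (permute π w) ≡ rel u w
      rel-from πu≐u′ w = ≡.trans (rel-cong (≐-sym πu≐u′) ≐-refl) (rel-permute π _ w)

      rel-to : ∀ {u u′} → permute π u ≐ u′ → ∀ w → rel (permute π w) u′ ≡ rel w u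
      rel-to πu≐u′ w = ≡.trans (rel-cong ≐-refl (≐-sym πu≐u′)) (rel-permute π w _)

      moved : ∀ w → κ (rel³ y′ (permute π w)) * κ′ (rel³ (permute π w) z′) ≡ κ (rel³ y w) * κ′ (rel³ w z)
      moved w = ≡.cong₂ _*_
        (≡.cong κ (≡.cong₂ _,_ (≡.sym (≡.cong proj₁ eq)) (≡.cong₂ _,_ (rel-from πy≐y′ w) (rel-from πx≐x w))))
        (≡.cong κ′ (≡.cong₂ _,_ (rel-from πx≐x w) (≡.cong₂ _,_ (rel-to πz≐z′ w) (≡.sym (≡.cong (proj₂ ∘ proj₂) eq)))))

    witnessʸ witnessᶻ : Triple → Pt n m
    witnessʸ (a , b , c) h = Coordinate.witnessʸ (lookup a h) (x h)
    witnessᶻ (a , b , c) h = Coordinate.witnessᶻ (lookup a h) (lookup b h) (lookup c h) (x h)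

    FactorsThroughRel³ : Mat → Set (c ⊔ ℓ)
    FactorsThroughRel³ M = Σ (Triple → Carrier) λ κ → ∀ y z → M y z ≈ κ (rel³ y z)
    module Witnessed (2≤m : ∀ h → 2 ℕ.≤ m h) where

      rel³-witness : ∀ {a b c} → Inℙ m a b c → rel³ (witnessʸ (a , b , c)) (witnessᶻ (a , b , c)) ≡ (a , b , c)
      rel³-witness {a} {b} {c} abc∈ℙ =
        ≡.cong₂ _,_ (component a (proj₁ ∘ coordinate))
                    (≡.cong₂ _,_ (component b (proj₁ ∘ proj₂ ∘ coordinate)) (component c (proj₂ ∘ proj₂ ∘ coordinate)))
        where
        coordinate = λ h → Coordinate.witness-pattern (2≤m h) (x h) (lookup a h) (lookup b h) (lookup c h)
                                                      (to (T-allᵇ n _) abc∈ℙ h)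

        component : ∀ {f} (g : Bits n) → (∀ h → f h ≡ lookup g h) → Vec.tabulate f ≡ g
        component g f≗g = ≡.sym (from (≡-tabulate⇔ g _) (λ h → ≡.sym (f≗g h)))

      basisElt-at-witness : ∀ s {a b c} → Inℙ m a b c →
        basisElt x s (witnessʸ (a , b , c)) (witnessᶻ (a , b , c)) ≈ [ does (s ≟³ (a , b , c)) ]
      basisElt-at-witness s abc∈ℙ =
        trans (basisElt-rel³ s _ _) (reflexive (≡.cong (λ t → [ does (s ≟³ t) ]) (rel³-witness abc∈ℙ)))

      InT⇒factorsThroughRel³ : ∀ {M} → InT x M → FactorsThroughRel³ M
      InT⇒factorsThroughRel³ (genA g) =
        (λ (a , b , c) → [ does (g ≟ᵇ b) ]) , λ y z → reflexive (≡.cong [_] (inRᵇ-rel g y z))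
      InT⇒factorsThroughRel³ (genE* g) =
        (λ (a , b , c) → [ does (zeros ≟ᵇ b) ∧ does (g ≟ᵇ a) ]) ,
        λ y z → reflexive (≡.cong [_] (≡.cong₂ _∧_ (eqᵇ-rel y z) (inRᵇ-rel g x y)))
      InT⇒factorsThroughRel³ one =
        (λ (a , b , c) → [ does (zeros ≟ᵇ b) ]) , λ y z → reflexive (≡.cong [_] (eqᵇ-rel y z))
      InT⇒factorsThroughRel³ nil = (λ _ → 0#) , λ y z → refl
      InT⇒factorsThroughRel³ (plus M∈T N∈T) =
        let κ , M≈κ = InT⇒factorsThroughRel³ M∈T; ν , N≈ν = InT⇒factorsThroughRel³ N∈T
        in (λ t → κ t + ν t) , λ y z → +-cong (M≈κ y z) (N≈ν y z)
      InT⇒factorsThroughRel³ (times M∈T N∈T) =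
        let κ , M≈κ = InT⇒factorsThroughRel³ M∈T; ν , N≈ν = InT⇒factorsThroughRel³ N∈T
        in (λ t → convolution κ ν (witnessʸ t) (witnessᶻ t)) ,
           λ y z → trans (∑-cong (allPt n m) (λ w → *-cong (M≈κ y w) (N≈ν w z)))
                         (convolution-invariant κ ν (≡.sym (rel³-witness (rel³-inℙ y z))))
      InT⇒factorsThroughRel³ (scale k M∈T) =
        let κ , M≈κ = InT⇒factorsThroughRel³ M∈T in (λ t → k * κ t) , λ y z → *-cong refl (M≈κ y z)
      InT⇒factorsThroughRel³ (resp M≈N M∈T) =
        let κ , M≈κ = InT⇒factorsThroughRel³ M∈T in κ , λ y z → trans (sym (M≈N y z)) (M≈κ y z)

      InT⇒∈span : ∀ M → InT x M → Σ (Triple → Carrier) λ κ → M ≈ₘ comb x κ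
      InT⇒∈span M M∈T =
        let κ , M≈κ = InT⇒factorsThroughRel³ M∈T in κ , λ y z → trans (M≈κ y z) (sym (comb-rel³ κ y z))

      comb≈0⇒coefficients≈0 : ∀ κ → comb x κ ≈ₘ 0ₘ → ∀ a b c → Inℙ m a b c → κ (a , b , c) ≈ 0#
      comb≈0⇒coefficients≈0 κ comb≈0 a b c abc∈ℙ = begin
        κ (a , b , c)            ≡⟨ ≡.cong κ (≡.sym (rel³-witness abc∈ℙ)) ⟩
        κ (rel³ (wʸ abc) (wᶻ abc)) ≈⟨ comb-rel³ κ _ _ ⟨
        comb x κ (wʸ abc) (wᶻ abc) ≈⟨ comb≈0 _ _ ⟩
        0#                       ∎
        where abc = (a , b , c); wʸ = witnessʸ; wᶻ = witnessᶻ

      basisElt-injective : ∀ {a b c} s → Inℙ m a b c → basisElt x (a , b , c) ≈ₘ basisElt x s → (a , b , c) ≡ s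
      basisElt-injective {a} {b} {c} s abc∈ℙ same with s ≟³ (a , b , c)
      ... | yes s≡abc = ≡.sym s≡abc
      ... | no  s≢abc = ⊥-elim (1≉0 (begin
        1#                                 ≡⟨ ≡.cong [_] (dec-true (abc ≟³ abc) ≡.refl) ⟨
        [ does (abc ≟³ abc) ]              ≈⟨ basisElt-at-witness abc abc∈ℙ ⟨
        basisElt x abc (wʸ abc) (wᶻ abc)   ≈⟨ same _ _ ⟩
        basisElt x s (wʸ abc) (wᶻ abc)     ≈⟨ basisElt-at-witness s abc∈ℙ ⟩
        [ does (s ≟³ abc) ]                ≡⟨ ≡.cong [_] (dec-false (s ≟³ abc) s≢abc) ⟩
        0#                                 ∎))
        where abc = (a , b , c); wʸ = witnessʸ; wᶻ = witnessᶻ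

module Cardinality where
  open import Data.Nat using (_+_; _*_; _^_)
  open ListSum ℕₚ.+-*-commutativeSemiring
  open ≡.≡-Reasoning

  [_] : Bool → ℕ
  [ b ] = if b then 1 else 0

  [∧] : ∀ p q → [ p ∧ q ] ≡ [ p ] * [ q ]
  [∧] true  q = ≡.sym (ℕₚ.+-identityʳ _)
  [∧] false q = ≡.refl

  length-filter≡∑ : ∀ {a p} {A : Set a} {P : Pred A p} (P? : Decidable P) (xs : List A) →
                    length (filter P? xs) ≡ ∑ xs (λ x → [ does (P? x) ])
  length-filter≡∑ P? []       = ≡.refl
  length-filter≡∑ P? (x ∷ xs) with does (P? x)
  ... | true  = ≡.cong suc (length-filter≡∑ P? xs)
  ... | false = length-filter≡∑ P? xs

  countᵇ-suc : ∀ k (p : Fin (suc k) → Bool) → countᵇ (suc k) p ≡ [ p zero ] + countᵇ k (p ∘ suc)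
  countᵇ-suc k p = begin
    countᵇ (suc k) p                                ≡⟨ length-filter≡∑ _ (allFin (suc k)) ⟩
    ∑ (allFin (suc k)) (λ a → [ p a ])              ≡⟨ ∑-allFin-suc k _ ⟩
    [ p zero ] + ∑ (allFin k) (λ a → [ p (suc a) ]) ≡⟨ ≡.cong ([ p zero ] +_) (length-filter≡∑ _ (allFin k)) ⟨
    [ p zero ] + countᵇ k (p ∘ suc)                 ∎

  indicatorℙ : ∀ {n} → (Fin n → ℕ) → Bits n × Bits n × Bits n → ℕ
  indicatorℙ m (a , b , c) = [ inℙᵇ m a b c ]

  cardℙ≡∑³ : ∀ n m → cardℙ n m ≡ ∑³ n (indicatorℙ m)
  cardℙ≡∑³ n m = ≡.trans (length-filter≡∑ _ (allTriples n)) (∑-allTriples n (indicatorℙ m))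

  -- coordinateCount true computes to 5 and coordinateCount false to 4.
  coordinateCount : Bool → ℕ
  coordinateCount big = ∑ bools λ a → ∑ bools λ b → ∑ bools λ c → [ inℙ₁ᵇ a b c big ]

  ∑³-indicatorℙ-suc : ∀ n (m : Fin (suc n) → ℕ) →
    ∑³ (suc n) (indicatorℙ m) ≡ coordinateCount (bigᵇ m zero) * ∑³ n (indicatorℙ (m ∘ suc))
  ∑³-indicatorℙ-suc n m = begin
    ∑³ (suc n) (indicatorℙ m)
      ≡⟨ ∑³-suc n (indicatorℙ m) ⟩
    (∑ bools λ a₀ → ∑ bools λ b₀ → ∑ bools λ c₀ → ∑³ n λ (a , b , c) → [ inℙᵇ m (a₀ ∷ᵥ a) (b₀ ∷ᵥ b) (c₀ ∷ᵥ c) ])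
      ≡⟨ (∑-cong bools λ a₀ → ∑-cong bools λ b₀ → ∑-cong bools λ c₀ →
          ∑-cong (allBits n) λ a → ∑-cong (allBits n) λ b → ∑-cong (allBits n) λ c → split-first a₀ b₀ c₀ a b c) ⟩
    (∑ bools λ a₀ → ∑ bools λ b₀ → ∑ bools λ c₀ → ∑³ n λ t → [ inℙ₁ᵇ a₀ b₀ c₀ big ] * rest t)
      ≡⟨ (∑-cong bools λ a₀ → ∑-cong bools λ b₀ → ∑-cong bools λ c₀ → ∑³-*ˡ [ inℙ₁ᵇ a₀ b₀ c₀ big ]) ⟩
    (∑ bools λ a₀ → ∑ bools λ b₀ → ∑ bools λ c₀ → [ inℙ₁ᵇ a₀ b₀ c₀ big ] * ∑³ n rest)
      ≡⟨ ∑-bools³-*ʳ (λ a₀ b₀ c₀ → [ inℙ₁ᵇ a₀ b₀ c₀ big ]) ⟨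
    coordinateCount big * ∑³ n rest ∎
    where
    big = bigᵇ m zero
    rest = indicatorℙ (m ∘ suc)

    split-first : ∀ a₀ b₀ c₀ a b c →
      [ inℙᵇ m (a₀ ∷ᵥ a) (b₀ ∷ᵥ b) (c₀ ∷ᵥ c) ] ≡ [ inℙ₁ᵇ a₀ b₀ c₀ big ] * rest (a , b , c)
    split-first a₀ b₀ c₀ a b c = ≡.trans
      (≡.cong [_] (allᵇ-suc n λ h → inℙ₁ᵇ (lookup (a₀ ∷ᵥ a) h) (lookup (b₀ ∷ᵥ b) h) (lookup (c₀ ∷ᵥ c) h) (bigᵇ m h)))
      ([∧] (inℙ₁ᵇ a₀ b₀ c₀ big) _)

    ∑³-*ˡ : ∀ k → ∑³ n (λ t → k * rest t) ≡ k * ∑³ n rest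
    ∑³-*ˡ k = ≡.sym (≡.trans (∑-*ˡ (allBits n) k _) (∑-cong (allBits n) λ a →
                      ≡.trans (∑-*ˡ (allBits n) k _) (∑-cong (allBits n) λ b → ∑-*ˡ (allBits n) k _)))

    ∑-bools³-*ʳ : ∀ (f : Bool → Bool → Bool → ℕ) →
      (∑ bools λ a₀ → ∑ bools λ b₀ → ∑ bools λ c₀ → f a₀ b₀ c₀) * ∑³ n rest ≡
      (∑ bools λ a₀ → ∑ bools λ b₀ → ∑ bools λ c₀ → f a₀ b₀ c₀ * ∑³ n rest)
    ∑-bools³-*ʳ f =
      ≡.trans (∑-*ʳ bools C (λ a₀ → ∑ bools λ b₀ → ∑ bools λ c₀ → f a₀ b₀ c₀)) (∑-cong bools λ a₀ →
      ≡.trans (∑-*ʳ bools C (λ b₀ → ∑ bools λ c₀ → f a₀ b₀ c₀)) (∑-cong bools λ b₀ →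
      ∑-*ʳ bools C (f a₀ b₀)))
      where C = ∑³ n rest
  four-times : ∀ k l → 4 * (2 ^ (2 * k) * 5 ^ l) ≡ 2 ^ (2 * suc k) * 5 ^ l
  four-times k l = begin
    4 * (2 ^ (2 * k) * 5 ^ l)     ≡⟨ ≡.sym (ℕₚ.*-assoc 4 (2 ^ (2 * k)) (5 ^ l)) ⟩
    2 ^ 2 * 2 ^ (2 * k) * 5 ^ l   ≡⟨ ≡.cong (_* 5 ^ l) (≡.sym (ℕₚ.^-distribˡ-+-* 2 2 (2 * k))) ⟩
    2 ^ (2 + 2 * k) * 5 ^ l       ≡⟨ ≡.cong (λ e → 2 ^ e * 5 ^ l) (≡.sym (ℕₚ.*-suc 2 k)) ⟩
    2 ^ (2 * suc k) * 5 ^ l       ∎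

  five-times : ∀ k l → 5 * (2 ^ (2 * k) * 5 ^ l) ≡ 2 ^ (2 * k) * 5 ^ suc l
  five-times k l = begin
    5 * (2 ^ (2 * k) * 5 ^ l)     ≡⟨ ≡.sym (ℕₚ.*-assoc 5 (2 ^ (2 * k)) (5 ^ l)) ⟩
    5 * 2 ^ (2 * k) * 5 ^ l       ≡⟨ ≡.cong (_* 5 ^ l) (ℕₚ.*-comm 5 (2 ^ (2 * k))) ⟩
    2 ^ (2 * k) * 5 * 5 ^ l       ≡⟨ ℕₚ.*-assoc (2 ^ (2 * k)) 5 (5 ^ l) ⟩
    2 ^ (2 * k) * 5 ^ suc l       ∎

  ∑³-indicatorℙ : ∀ n (m : Fin n → ℕ) → (∀ h → 2 ℕ.≤ m h) →
                  ∑³ n (indicatorℙ m) ≡ 2 ^ (2 * n₁ n m) * 5 ^ n₂ n m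
  ∑³-indicatorℙ zero    m 2≤m = ≡.refl
  ∑³-indicatorℙ (suc n) m 2≤m
    rewrite ∑³-indicatorℙ-suc n m | ∑³-indicatorℙ n (m ∘ suc) (2≤m ∘ suc)
          | countᵇ-suc n (λ a → ⌊ m a ℕ.≟ 2 ⌋) | countᵇ-suc n (bigᵇ m)
    with m zero ℕ.≟ 2 | 2 ℕ.<? m zero
  ... | yes m₀≡2 | yes 2<m₀ = ⊥-elim (ℕₚ.<-irrefl (≡.sym m₀≡2) 2<m₀)
  ... | yes _    | no  _    = four-times (n₁ n (m ∘ suc)) (n₂ n (m ∘ suc))
  ... | no  _    | yes _    = five-times (n₁ n (m ∘ suc)) (n₂ n (m ∘ suc))
  ... | no  m₀≢2 | no  2≮m₀ = ⊥-elim (m₀≢2 (ℕₚ.≤-antisym (ℕₚ.≮⇒≥ 2≮m₀) (2≤m zero)))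

open import Data.Nat using (_≤_; _*_; _^_)

theorem3p5 : ∀ {c ℓ : Level} (𝔽 : Field c ℓ) (n : ℕ) → 1 ≤ n →
    (m : Fin n → ℕ) → (∀ h → 2 ≤ m h) → (x : Pt n m) →
    let open Matrices 𝔽 n m in
    (∀ a b c → Inℙ m a b c → InT x (basisElt x (a , b , c)))
    × (∀ (κ : Triple → Field.Carrier 𝔽) → comb x κ ≈ₘ 0ₘ →
    ∀ a b c → Inℙ m a b c → Field._≈_ 𝔽 (κ (a , b , c)) (Field.0# 𝔽))
    × (∀ M → InT x M → Σ (Triple → Field.Carrier 𝔽) (λ κ → M ≈ₘ comb x κ))
    × (∀ a b c a′ b′ c′ → Inℙ m a b c → Inℙ m a′ b′ c′ →
    basisElt x (a , b , c) ≈ₘ basisElt x (a′ , b′ , c′) →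
    (a , b , c) ≡ (a′ , b′ , c′))
    × cardℙ n m ≡ 2 ^ (2 * n₁ n m) * 5 ^ n₂ n m
theorem3p5 𝔽 n _ m 2≤m x =
    (λ a b c _ → times (times (genE* a) (genA b)) (genE* c))
  , comb≈0⇒coefficients≈0
  , InT⇒∈span
  , (λ a b c a′ b′ c′ abc∈ℙ _ → basisElt-injective (a′ , b′ , c′) abc∈ℙ)
  , ≡.trans (Cardinality.cardℙ≡∑³ n m) (Cardinality.∑³-indicatorℙ n m 2≤m)
  where
  open Matrices 𝔽 n m using (genA; genE*; times)
  open Terwilliger 𝔽 n m
  open BasePoint x
  open Witnessed 2≤m
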